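{- Let $n \geqslant 3$ and let $k$ be an integer with $k \geqslant \lfloor n/2 \rfloor$ such that $n$ and $k$ have different parities. Let $f$ be a radio-$k$-labeling of $C_n$, with vertices ordered $x_0,\ldots,x_{n-1}$ so that $f(x_0) < \cdots < f(x_{n-1})$, and let $f_i = f(x_{i+1}) - f(x_i)$. If for some $i \in \{0,\ldots,n-3\}$ we have $f_i + f_{i+1} = \varPhi(n,k) = \frac{3k-n+3}{2}$, then $d(x_i, x_{i+2}) = k + 1 - \varPhi(n,k) = \frac{n-k-1}{2}$.
   Context: $C_n$ is the cycle on vertex set $\mathbb{Z}_n$, with $u,v$ adjacent iff $u \equiv v \pm 1 \pmod n$; $d(u,v)$ is the graph distance. A radio-$k$-labeling of $C_n$ is a function $f \colon V(C_n) \to \{0,1,2,\ldots\}$ with $|f(u)-f(v)| \geqslant k - d(u,v) + 1$ for all distinct $u,v$; for $k \geqslant \lfloor n/2\rfloor$ it is injective, so the increasing ordering is well defined. $\varPhi(n,k) = \lceil (3k+3-n)/2 \rceil$, which equals $(3k-n+3)/2$ when $n \not\equiv k \pmod 2$. -}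

module Defs where

open import Data.Nat using (ℕ; zero; suc; _+_; _*_; _∸_; _≤_; _<_; _⊓_)
open import Data.Nat.Base using (∣_-_∣; ⌈_/2⌉)
open import Data.Fin using (Fin; toℕ)
open import Relation.Binary.PropositionalEquality using (_≡_; _≢_)

cycDist : (n : ℕ) → Fin n → Fin n → ℕ
cycDist n u v = ∣ toℕ u - toℕ v ∣ ⊓ (n ∸ ∣ toℕ u - toℕ v ∣)

-- Radio-k-labeling of C_n: |f(u) - f(v)| ≥ k - d(u,v) + 1 for all distinct u, v.
-- Stated over ℕ as |f(u)-f(v)| + d(u,v) ≥ k + 1 (equivalent over the integers).
IsRadioKLabeling : (n k : ℕ) → (Fin n → ℕ) → Set
IsRadioKLabeling n k f =
  ∀ (u v : Fin n) → u ≢ v → k + 1 ≤ ∣ f u - f v ∣ + cycDist n u v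

-- Φ(n,k) = ⌈(3k + 3 - n)/2⌉ (the argument is positive whenever k ≥ ⌊n/2⌋).
Φ : ℕ → ℕ → ℕ
Φ n k = ⌈ (3 * k + 3 ∸ n) /2⌉

open import Data.Nat.Properties using (<-trans; n<1+n; +-comm)
open import Data.Fin using (fromℕ<)

idx0 : ∀ {n} i → i + 2 < n → Fin n
idx0 i p = fromℕ< (<-trans (<-trans (n<1+n i) (n<1+n (suc i))) (subst' p))
  where
  subst' : ∀ {n} → i + 2 < n → suc (suc i) < n
  subst' {n} q rewrite +-comm i 2 = q
idx1 : ∀ {n} i → i + 2 < n → Fin n
idx1 i p = fromℕ< (<-trans (n<1+n (suc i)) (subst' p))
  where
  subst' : ∀ {n} → i + 2 < n → suc (suc i) < n
  subst' {n} q rewrite +-comm i 2 = q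
idx2 : ∀ {n} i → i + 2 < n → Fin n
idx2 i p = fromℕ< p

-- The ordering gives three radio conditions on x_i, x_{i+1}, x_{i+2}, with label gaps f_i, f_{i+1}
-- and f_i + f_{i+1} = Φ. Any three vertices of C_n have pairwise distances summing to at most n
-- (two short arcs plus the complement of their union). Adding the two conditions for consecutive
-- vertices and the perimeter bound gives 2(k+1) + d(x_i,x_{i+2}) + Φ ≤ 2Φ + n, and the parity
-- hypothesis makes 2Φ + n = 3(k+1) exactly; hence d(x_i,x_{i+2}) ≤ k + 1 − Φ, while the radio
-- condition for x_i, x_{i+2} gives the reverse inequality.
module Submission where

open import Defs
open import Data.Nat using (ℕ; _+_; _∸_; _≤_; _<_; _%_; ⌊_/2⌋)
open import Data.Fin using (Fin) renaming (_<_ to _<ᶠ_)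
open import Relation.Binary.PropositionalEquality using (_≡_)

open import Data.Nat.Base using (zero; suc; _*_; _⊓_; ∣_-_∣; ⌈_/2⌉; z≤n; s≤s)
open import Data.Nat.Properties
open import Data.Nat.DivMod using (m≡m%n+[m/n]*n; _/_)
open import Data.Nat.Tactic.RingSolver using (solve-∀)
open import Data.Fin using (toℕ)
open import Data.Fin.Properties using (toℕ-fromℕ<; toℕ<n)
open import Data.Sum using (inj₁; inj₂)
open import Relation.Binary.PropositionalEquality
  using (_≢_; refl; sym; trans; cong; subst; subst₂; module ≡-Reasoning)

o∸m≡[o∸n]+[n∸m] : ∀ {m n o} → m ≤ n → n ≤ o → o ∸ m ≡ (o ∸ n) + (n ∸ m)
o∸m≡[o∸n]+[n∸m] {m} {n} {o} m≤n n≤o = begin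
  o ∸ m             ≡⟨ cong (_∸ m) (sym (m∸n+n≡m n≤o)) ⟩
  (o ∸ n) + n ∸ m   ≡⟨ +-∸-assoc (o ∸ n) m≤n ⟩
  (o ∸ n) + (n ∸ m) ∎
  where open ≡-Reasoning

-- cycDist on natural-number representatives, so that the perimeter bound can sort them.
arcDist : ℕ → ℕ → ℕ → ℕ
arcDist n a b = ∣ a - b ∣ ⊓ (n ∸ ∣ a - b ∣)

arcDist-comm : ∀ n a b → arcDist n a b ≡ arcDist n b a
arcDist-comm n a b = cong (λ d → d ⊓ (n ∸ d)) (∣-∣-comm a b)

arcDist≤∣-∣ : ∀ n a b → arcDist n a b ≤ ∣ a - b ∣
arcDist≤∣-∣ n a b = m⊓n≤m ∣ a - b ∣ (n ∸ ∣ a - b ∣)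

arcDist≤n∸∣-∣ : ∀ n a b → arcDist n a b ≤ n ∸ ∣ a - b ∣
arcDist≤n∸∣-∣ n a b = m⊓n≤n ∣ a - b ∣ (n ∸ ∣ a - b ∣)

perimeter : ℕ → ℕ → ℕ → ℕ → ℕ
perimeter n a b c = arcDist n a b + arcDist n b c + arcDist n a c

perimeter-swapˡ : ∀ n a b c → perimeter n b a c ≡ perimeter n a b c
perimeter-swapˡ n a b c = begin
  arcDist n b a + arcDist n a c + arcDist n b c
    ≡⟨ cong (λ d → d + arcDist n a c + arcDist n b c) (arcDist-comm n b a) ⟩
  arcDist n a b + arcDist n a c + arcDist n b c
    ≡⟨ swap (arcDist n a b) (arcDist n a c) (arcDist n b c) ⟩
  arcDist n a b + arcDist n b c + arcDist n a c ∎
  where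
  open ≡-Reasoning
  swap : ∀ x y z → x + y + z ≡ x + z + y
  swap = solve-∀

perimeter-swapʳ : ∀ n a b c → perimeter n a c b ≡ perimeter n a b c
perimeter-swapʳ n a b c = begin
  arcDist n a c + arcDist n c b + arcDist n a b
    ≡⟨ cong (λ d → arcDist n a c + d + arcDist n a b) (arcDist-comm n c b) ⟩
  arcDist n a c + arcDist n b c + arcDist n a b
    ≡⟨ reverse (arcDist n a b) (arcDist n b c) (arcDist n a c) ⟩
  arcDist n a b + arcDist n b c + arcDist n a c ∎
  where
  open ≡-Reasoning
  reverse : ∀ x y z → z + y + x ≡ x + y + z
  reverse = solve-∀

-- For a ≤ b ≤ c, go the short way along the first two sides and the long way along the third.
perimeter-sorted≤n : ∀ {n a b c} → a ≤ b → b ≤ c → c ≤ n → perimeter n a b c ≤ n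
perimeter-sorted≤n {n} {a} {b} {c} a≤b b≤c c≤n = begin
  arcDist n a b + arcDist n b c + arcDist n a c
    ≤⟨ +-mono-≤ (+-mono-≤ (arcDist≤∣-∣ n a b) (arcDist≤∣-∣ n b c)) (arcDist≤n∸∣-∣ n a c) ⟩
  ∣ a - b ∣ + ∣ b - c ∣ + (n ∸ ∣ a - c ∣)
    ≡⟨ cong₃ (m≤n⇒∣m-n∣≡n∸m a≤b) (m≤n⇒∣m-n∣≡n∸m b≤c) (m≤n⇒∣m-n∣≡n∸m a≤c) ⟩
  (b ∸ a) + (c ∸ b) + (n ∸ (c ∸ a))
    ≡⟨ cong (_+ (n ∸ (c ∸ a))) (trans (+-comm (b ∸ a) (c ∸ b)) (sym (o∸m≡[o∸n]+[n∸m] a≤b b≤c))) ⟩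
  (c ∸ a) + (n ∸ (c ∸ a))
    ≡⟨ m+[n∸m]≡n (≤-trans (m∸n≤m c a) c≤n) ⟩
  n ∎
  where
  open ≤-Reasoning
  a≤c = ≤-trans a≤b b≤c
  cong₃ : ∀ {x x′ y y′ z z′} → x ≡ x′ → y ≡ y′ → z ≡ z′ → x + y + (n ∸ z) ≡ x′ + y′ + (n ∸ z′)
  cong₃ refl refl refl = refl

perimeter≤n : ∀ {n a b c} → a ≤ n → b ≤ n → c ≤ n → perimeter n a b c ≤ n
perimeter≤n {n} {a} {b} {c} a≤n b≤n c≤n with ≤-total a b | ≤-total b c | ≤-total a c
... | inj₁ a≤b | inj₁ b≤c | _ = perimeter-sorted≤n a≤b b≤c c≤n
... | inj₁ a≤b | inj₂ c≤b | inj₁ a≤c =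
  subst (_≤ n) (perimeter-swapʳ n a b c) (perimeter-sorted≤n a≤c c≤b b≤n)
... | inj₁ a≤b | inj₂ c≤b | inj₂ c≤a =
  subst (_≤ n) (trans (perimeter-swapˡ n a c b) (perimeter-swapʳ n a b c)) (perimeter-sorted≤n c≤a a≤b b≤n)
... | inj₂ b≤a | inj₁ b≤c | inj₁ a≤c =
  subst (_≤ n) (perimeter-swapˡ n a b c) (perimeter-sorted≤n b≤a a≤c c≤n)
... | inj₂ b≤a | inj₁ b≤c | inj₂ c≤a =
  subst (_≤ n) (trans (perimeter-swapʳ n b a c) (perimeter-swapˡ n a b c)) (perimeter-sorted≤n b≤c c≤a a≤n)
... | inj₂ b≤a | inj₂ c≤b | _ =
  subst (_≤ n) (trans (perimeter-swapˡ n b c a) (trans (perimeter-swapʳ n b a c) (perimeter-swapˡ n a b c)))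
      (perimeter-sorted≤n c≤b b≤a a≤n)

⌈m+[n+n]/2⌉≡⌈m/2⌉+n : ∀ m n → ⌈ m + (n + n) /2⌉ ≡ ⌈ m /2⌉ + n
⌈m+[n+n]/2⌉≡⌈m/2⌉+n m zero rewrite +-identityʳ m | +-identityʳ ⌈ m /2⌉ = refl
⌈m+[n+n]/2⌉≡⌈m/2⌉+n m (suc n)
  rewrite +-suc n n | +-suc m (suc (n + n)) | +-suc m (n + n) | +-suc ⌈ m /2⌉ n
  = cong suc (⌈m+[n+n]/2⌉≡⌈m/2⌉+n m n)

n≤1+⌊n/2⌋+⌊n/2⌋ : ∀ n → n ≤ suc (⌊ n /2⌋ + ⌊ n /2⌋)
n≤1+⌊n/2⌋+⌊n/2⌋ zero = z≤n
n≤1+⌊n/2⌋+⌊n/2⌋ (suc zero) = s≤s z≤n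
n≤1+⌊n/2⌋+⌊n/2⌋ (suc (suc n)) rewrite +-suc ⌊ n /2⌋ ⌊ n /2⌋ = s≤s (s≤s (n≤1+⌊n/2⌋+⌊n/2⌋ n))

-- When n + k is odd, 3k + 3 − n is even, so the ceiling in Φ is exact.
Φ+Φ+n≡3[k+1] : ∀ n k → ⌊ n /2⌋ ≤ k → (n + k) % 2 ≡ 1
  → Φ n k + Φ n k + n ≡ (k + 1) + (k + 1) + (k + 1)
Φ+Φ+n≡3[k+1] n k ⌊n/2⌋≤k n+k-odd = +-cancelʳ-≡ k _ _ (begin
  Φ n k + Φ n k + n + k               ≡⟨ +-assoc (Φ n k + Φ n k) n k ⟩
  Φ n k + Φ n k + (n + k)             ≡⟨ cong (Φ n k + Φ n k +_) n+k≡1+q+q ⟩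
  Φ n k + Φ n k + suc (q + q)         ≡⟨ regroup (Φ n k) q ⟩
  suc ((Φ n k + q) + (Φ n k + q))     ≡⟨ cong (λ t → suc (t + t)) Φ+q≡2k+1 ⟩
  suc ((2k+1) + (2k+1))               ≡⟨ expand k ⟩
  (k + 1) + (k + 1) + (k + 1) + k     ∎)
  where
  open ≡-Reasoning
  m = 3 * k + 3 ∸ n
  q = (n + k) / 2
  2k+1 = suc (k + k)
  regroup : ∀ P q → P + P + suc (q + q) ≡ suc ((P + q) + (P + q))
  regroup = solve-∀
  expand : ∀ k → suc (suc (k + k) + suc (k + k)) ≡ (k + 1) + (k + 1) + (k + 1) + k
  expand = solve-∀
  n+k≡1+q+q : n + k ≡ suc (q + q)
  n+k≡1+q+q = begin
    n + k                        ≡⟨ m≡m%n+[m/n]*n (n + k) 2 ⟩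
    (n + k) % 2 + q * 2          ≡⟨ cong (_+ q * 2) n+k-odd ⟩
    1 + q * 2                    ≡⟨ double q ⟩
    suc (q + q)                  ∎
    where
    double : ∀ q → 1 + q * 2 ≡ suc (q + q)
    double = solve-∀
  m+n≡3k+3 : m + n ≡ 3 * k + 3
  m+n≡3k+3 = m∸n+n≡m (≤-trans (n≤1+⌊n/2⌋+⌊n/2⌋ n)
    (≤-trans (s≤s (+-mono-≤ ⌊n/2⌋≤k ⌊n/2⌋≤k))
    (≤-trans (m≤m+n (suc (k + k)) (suc (suc k))) (≤-reflexive (three k)))))
    where
    three : ∀ k → suc (k + k) + suc (suc k) ≡ 3 * k + 3
    three = solve-∀
  m+[q+q]≡2k+1+2k+1 : m + (q + q) ≡ 2k+1 + 2k+1
  m+[q+q]≡2k+1+2k+1 = suc-injective (begin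
    suc (m + (q + q))      ≡⟨ sym (+-suc m (q + q)) ⟩
    m + suc (q + q)        ≡⟨ cong (m +_) (sym n+k≡1+q+q) ⟩
    m + (n + k)            ≡⟨ sym (+-assoc m n k) ⟩
    m + n + k              ≡⟨ cong (_+ k) m+n≡3k+3 ⟩
    3 * k + 3 + k          ≡⟨ four k ⟩
    suc (2k+1 + 2k+1)      ∎)
    where
    four : ∀ k → 3 * k + 3 + k ≡ suc (suc (k + k) + suc (k + k))
    four = solve-∀
  Φ+q≡2k+1 : Φ n k + q ≡ 2k+1
  Φ+q≡2k+1 = begin
    ⌈ m /2⌉ + q            ≡⟨ sym (⌈m+[n+n]/2⌉≡⌈m/2⌉+n m q) ⟩
    ⌈ m + (q + q) /2⌉      ≡⟨ cong ⌈_/2⌉ m+[q+q]≡2k+1+2k+1 ⟩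
    ⌈ 2k+1 + 2k+1 /2⌉      ≡⟨ sym (n≡⌈n+n/2⌉ 2k+1) ⟩
    2k+1                   ∎

third-distance-forced : ∀ {n K P X Y d₀₁ d₁₂ d₀₂}
  → P + P + n ≡ K + K + K → X + Y ≡ P → d₀₁ + d₁₂ + d₀₂ ≤ n
  → K ≤ X + d₀₁ → K ≤ Y + d₁₂ → K ≤ P + d₀₂
  → d₀₂ ≡ K ∸ P
third-distance-forced {n} {K} {P} {X} {Y} {d₀₁} {d₁₂} {d₀₂} 2P+n≡3K X+Y≡P perim≤n K≤X+d₀₁ K≤Y+d₁₂ K≤P+d₀₂ =
  trans (sym (m+n∸n≡m d₀₂ P)) (cong (_∸ P) d₀₂+P≡K)
  where
  open ≤-Reasoning
  regroup : ∀ X d₀₁ Y d₁₂ d₀₂ P → (X + d₀₁) + (Y + d₁₂) + (d₀₂ + P) ≡ (X + Y) + (d₀₁ + d₁₂ + d₀₂) + P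
  regroup = solve-∀
  swap : ∀ P n → P + n + P ≡ P + P + n
  swap = solve-∀
  2K+[d₀₂+P]≤3K : K + K + (d₀₂ + P) ≤ K + K + K
  2K+[d₀₂+P]≤3K = begin
    K + K + (d₀₂ + P)                         ≤⟨ +-monoˡ-≤ (d₀₂ + P) (+-mono-≤ K≤X+d₀₁ K≤Y+d₁₂) ⟩
    (X + d₀₁) + (Y + d₁₂) + (d₀₂ + P)         ≡⟨ regroup X d₀₁ Y d₁₂ d₀₂ P ⟩
    (X + Y) + (d₀₁ + d₁₂ + d₀₂) + P           ≤⟨ +-monoˡ-≤ P (+-monoʳ-≤ (X + Y) perim≤n) ⟩
    (X + Y) + n + P                           ≡⟨ cong (λ s → s + n + P) X+Y≡P ⟩
    P + n + P                                 ≡⟨ swap P n ⟩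
    P + P + n                                 ≡⟨ 2P+n≡3K ⟩
    K + K + K                                 ∎
  d₀₂+P≡K : d₀₂ + P ≡ K
  d₀₂+P≡K = ≤-antisym (+-cancelˡ-≤ (K + K) _ _ 2K+[d₀₂+P]≤3K) (subst (K ≤_) (+-comm P d₀₂) K≤P+d₀₂)

radio-ordered : ∀ {n k f} → IsRadioKLabeling n k f → ∀ {u v} → u ≢ v → f u ≤ f v
  → k + 1 ≤ (f v ∸ f u) + cycDist n u v
radio-ordered {n} {k} {f} radio {u} {v} u≢v fu≤fv =
  subst (λ s → k + 1 ≤ s + cycDist n u v) (m≤n⇒∣m-n∣≡n∸m fu≤fv) (radio u v u≢v)

idx0<idx1 : ∀ {n} i (p : i + 2 < n) → idx0 i p <ᶠ idx1 i p
idx0<idx1 i p = subst₂ _<_ (sym (toℕ-fromℕ< _)) (sym (toℕ-fromℕ< _)) (n<1+n i)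

idx1<idx2 : ∀ {n} i (p : i + 2 < n) → idx1 i p <ᶠ idx2 i p
idx1<idx2 i p = subst₂ _<_ (sym (toℕ-fromℕ< _)) (sym (trans (toℕ-fromℕ< p) (+-comm i 2))) (n<1+n (suc i))

lemma4p1 : (n k : ℕ) → 3 ≤ n → ⌊ n /2⌋ ≤ k → (n + k) % 2 ≡ 1
    → (f : Fin n → ℕ) → IsRadioKLabeling n k f
    → (x : Fin n → Fin n) → (∀ a b → x a ≡ x b → a ≡ b)
    → (∀ (a b : Fin n) → a <ᶠ b → f (x a) < f (x b))
    → (i : ℕ) → (p : i + 2 < n)
    → (f (x (idx1 i p)) ∸ f (x (idx0 i p))) + (f (x (idx2 i p)) ∸ f (x (idx1 i p))) ≡ Φ n k
    → cycDist n (x (idx0 i p)) (x (idx2 i p)) ≡ k + 1 ∸ Φ n k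
lemma4p1 n k _ ⌊n/2⌋≤k n+k-odd f radio x x-injective f∘x-increasing i p f₀+f₁≡Φ =
  third-distance-forced {X = f (x i₁) ∸ f (x i₀)} {Y = f (x i₂) ∸ f (x i₁)}
    {d₀₁ = cycDist n (x i₀) (x i₁)} {d₁₂ = cycDist n (x i₁) (x i₂)} (Φ+Φ+n≡3[k+1] n k ⌊n/2⌋≤k n+k-odd) f₀+f₁≡Φ
    (perimeter≤n (<⇒≤ (toℕ<n (x i₀))) (<⇒≤ (toℕ<n (x i₁))) (<⇒≤ (toℕ<n (x i₂))))
    (consecutive i₀<i₁) (consecutive i₁<i₂)
    (subst (λ s → k + 1 ≤ s + cycDist n (x i₀) (x i₂)) f₂∸f₀≡Φ (consecutive i₀<i₂))
  where
  i₀ = idx0 i p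
  i₁ = idx1 i p
  i₂ = idx2 i p
  i₀<i₁ = idx0<idx1 i p
  i₁<i₂ = idx1<idx2 i p
  i₀<i₂ = <-trans i₀<i₁ i₁<i₂
  increasing : ∀ {a b} → a <ᶠ b → f (x a) ≤ f (x b)
  increasing a<b = <⇒≤ (f∘x-increasing _ _ a<b)
  consecutive : ∀ {a b} → a <ᶠ b → k + 1 ≤ (f (x b) ∸ f (x a)) + cycDist n (x a) (x b)
  consecutive a<b = radio-ordered {f = f} radio
    (λ xa≡xb → <-irrefl (cong toℕ (x-injective _ _ xa≡xb)) a<b) (increasing a<b)
  f₂∸f₀≡Φ : f (x i₂) ∸ f (x i₀) ≡ Φ n k
  f₂∸f₀≡Φ = begin
    f (x i₂) ∸ f (x i₀)                               ≡⟨ o∸m≡[o∸n]+[n∸m] (increasing i₀<i₁) (increasing i₁<i₂) ⟩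
    (f (x i₂) ∸ f (x i₁)) + (f (x i₁) ∸ f (x i₀))     ≡⟨ +-comm (f (x i₂) ∸ f (x i₁)) _ ⟩
    (f (x i₁) ∸ f (x i₀)) + (f (x i₂) ∸ f (x i₁))     ≡⟨ f₀+f₁≡Φ ⟩
    Φ n k                                             ∎
    where open ≡-Reasoning
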